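{- Let $(\vec t_n)_{n=0}^\infty$ be a sequence in $V^\infty(A)$, with $\vec t_n=(t^{(n)}_i(x))_{i=0}^\infty$, let $(w_n(x))_{n=0}^\infty$ be a sequence of variable words, and let $(k_n)_{n=0}^\infty$ and $(m_n)_{n=0}^\infty$ be sequences in $\mathbb{N}$ with $m_0=0$. Assume that for every $n\geq1$: (i) $m_n\geq1$ and $k_n=k_{n-1}+m_n$; (ii) $w_{n-1}(x)\in[(t^{(n-1)}_i(x))_{i=0}^{m_n-1}\parallel(A_{k_{n-1}+i})_{i=0}^{m_n-1}]_v$; (iii) $\vec t_n$ is an infinite reduced $k_n$-block subsequence of $(t^{(n-1)}_i(x))_{i=m_n}^\infty$. Then there exists a strictly increasing sequence $(p_n)_{n=0}^\infty$ in $\mathbb{N}$ with $p_0=0$ such that for every $n\in\mathbb{N}$: (C1) $k_0+p_n\geq k_n$; (C2) $w_n(x)\in[(t^{(0)}_i(x))_{i=p_n}^{p_{n+1}-1}\parallel(A_{k_0+i})_{i=p_n}^{p_{n+1}-1}]_v$; (C3) $(w_i(x))_{i=n}^\infty$ is a reduced $k_n$-block subsequence of $\vec t_n$.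
   Context: $\mathbb{N}=\{0,1,2,\dots\}$. Fix an increasing sequence $A_0\subseteq A_1\subseteq\cdots$ of nonempty finite sets and let $A=\bigcup_nA_n$. Words over a set are finite sequences, concatenated by juxtaposition. Fix a symbol $x\notin A$. A variable word is a finite word over $A\cup\{x\}$ containing $x$ at least once; $V(A)$ is the set of variable words and $V^\infty(A)$ the set of infinite sequences of variable words. For $s(x)\in V(A)$ and $a\in A\cup\{x\}$, $s(a)$ replaces every occurrence of $x$ by $a$. For variable words $(s_n(x))_{n=p}^q$ and nonempty $B_p,\dots,B_q\subseteq A$, the reduced variable span is $[(s_n(x))_{n=p}^q\parallel(B_n)_{n=p}^q]_v=V(A)\cap\{s_p(b_p)s_{p+1}(b_{p+1})\cdots s_q(b_q): b_n\in B_n\cup\{x\}\}$. For $k\in\mathbb{N}$ and $\vec s=(s_n(x))_{n=0}^\infty\in V^\infty(A)$, a finite sequence $(t_n(x))_{n=0}^l$ is a reduced $k$-block subsequence of $\vec s$ if there are $0=m_0<m_1<\dots<m_{l+1}$ with $t_i(x)\in[(s_n(x))_{n=m_i}^{m_{i+1}-1}\parallel(A_{k+n})_{n=m_i}^{m_{i+1}-1}]_v$ for $0\leq i\leq l$; an infinite sequence is a reduced $k$-block subsequence of $\vec s$ if all its finite initial segments are. A tail $(s_n(x))_{n=m}^\infty$ is regarded as the sequence $(s_{m+n}(x))_{n=0}^\infty$; likewise $(w_i(x))_{i=n}^\infty$ is regarded as $(w_{n+i}(x))_{i=0}^\infty$. -}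

module Defs where

open import Data.Nat using (ℕ; zero; suc; _+_; _∸_; _<_; _≤_)
open import Data.List using (List; []; _∷_; _++_; map)
open import Data.List.Relation.Unary.Any using (Any)
open import Data.List.Membership.Propositional using (_∈_)
open import Data.Maybe using (Maybe; just; nothing)
open import Data.Product using (Σ; _×_; ∃; _,_)
open import Data.Sum using (_⊎_)
open import Relation.Binary.PropositionalEquality using (_≡_)

-- Letters of A ∪ {x}: `just a` is the letter a ∈ A, `nothing` is the variable x.
Word : Set → Set
Word Sym = List (Maybe Sym)

IsVar : {Sym : Set} → Word Sym → Set
IsVar w = Any (λ c → c ≡ nothing) w

subst-x : {Sym : Set} → Maybe Sym → Maybe Sym → Maybe Sym
subst-x b nothing  = b
subst-x b (just a) = just a

sub : {Sym : Set} → Word Sym → Maybe Sym → Word Sym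
sub s b = map (subst-x b) s

InOrX : {Sym : Set} → List Sym → Maybe Sym → Set
InOrX B b = (b ≡ nothing) ⊎ (Σ _ λ a → (b ≡ just a) × (a ∈ B))

-- Prod s B i l w :  w = s_i(b_i) s_{i+1}(b_{i+1}) ⋯ s_{i+l-1}(b_{i+l-1})
-- for some b_j ∈ B_j ∪ {x}.
Prod : {Sym : Set} → (ℕ → Word Sym) → (ℕ → List Sym) → ℕ → ℕ → Word Sym → Set
Prod s B i zero    w = w ≡ []
Prod s B i (suc l) w =
  Σ _ λ b → InOrX (B i) b × Σ _ λ w' → Prod s B (suc i) l w' × (w ≡ sub (s i) b ++ w')

-- Span s B p l w :  w ∈ [(s_n(x))_{n=p}^{p+l-1} ∥ (B_n)_{n=p}^{p+l-1}]_v
Span : {Sym : Set} → (ℕ → Word Sym) → (ℕ → List Sym) → ℕ → ℕ → Word Sym → Set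
Span s B p l w = IsVar w × Prod s B p l w

-- (t_i)_{i=0}^{l} is a reduced k-block subsequence of s.
FinBlockSub : {Sym : Set} → (ℕ → List Sym) → ℕ → (ℕ → Word Sym) → (ℕ → Word Sym) → ℕ → Set
FinBlockSub A k s t l =
  Σ (ℕ → ℕ) λ m → (m 0 ≡ 0)
    × (∀ i → i ≤ l → m i < m (suc i))
    × (∀ i → i ≤ l → Span s (λ n → A (k + n)) (m i) (m (suc i) ∸ m i) (t i))

-- The infinite sequence t is a reduced k-block subsequence of s:
-- all finite initial segments are.
InfBlockSub : {Sym : Set} → (ℕ → List Sym) → ℕ → (ℕ → Word Sym) → (ℕ → Word Sym) → Set
InfBlockSub A k s t = ∀ l → FinBlockSub A k s t l

-- Say u 0, …, u (L − 1) is decomposed into blocks of s at N 0 < ⋯ < N L when each u i is a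
-- reduced product of s over [N i, N (i + 1)). Block decompositions compose (at N ∘ M), and
-- since variable words are nonempty, one is determined by its start N 0 (compare lengths
-- block by block). Composing the decomposition of w (n + 1), w (n + 2), … in t (n + 1) with
-- that of t (n + 1) in the tail of t n, and prepending the block of w n, decomposes
-- w n, w (n + 1), … in t n, which is C3; along the way k (n + i) ≤ k n + N i, giving C1.
-- For n = 0 the decompositions of different lengths agree by uniqueness, and p collects them.
module Submission where

open import Defs
open import Data.Nat using (ℕ; zero; suc; _+_; _∸_; _<_; _≤_; z≤n; s≤s; _≤′_; ≤′-refl; ≤′-step)
open import Data.Nat.Properties
open import Data.List using (List; []; _∷_; _++_; length)
open import Data.List.Properties using (map-++; map-∘; map-cong; length-++; length-map; ++-assoc)
open import Data.List.Relation.Binary.Subset.Propositional using (_⊆_)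
open import Data.List.Membership.Propositional using (_∈_)
open import Data.Maybe using (Maybe; just; nothing)
open import Data.Product using (Σ; _×_; ∃; _,_; proj₁; proj₂)
open import Data.Sum using (inj₁; inj₂)
open import Relation.Nullary using (contradiction)
open import Function using (_∘_)
open import Relation.Binary.PropositionalEquality

private
  variable
    Sym X : Set
    s t u : ℕ → Word Sym
    B : ℕ → List Sym
    A : ℕ → List Sym
    w w′ : Word Sym
    a e i j k k′ l l′ L L′ : ℕ
    M N : ℕ → ℕ

sub-sub : (v : Word Sym) (b c : Maybe Sym) → sub (sub v c) b ≡ sub v (subst-x b c)
sub-sub v b c = trans (sym (map-∘ v)) (map-cong subst-x-subst-x v)
  where
  subst-x-subst-x : ∀ y → subst-x b (subst-x c y) ≡ subst-x (subst-x b c) y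
  subst-x-subst-x nothing  = refl
  subst-x-subst-x (just _) = refl

Prod-sub : ∀ {b} → (∀ j → i ≤ j → InOrX (B j) b) → Prod s B i l w → Prod s B i l (sub w b)
Prod-sub {l = zero} _ refl = refl
Prod-sub {i = i} {B = B} {s = s} {l = suc l} {b = b} allowed (c , c∈ , w′ , pr , refl) =
  subst-x b c , substituted c∈ , sub w′ b , Prod-sub (λ j → allowed j ∘ ≤-trans (n≤1+n i)) pr ,
  trans (map-++ (subst-x b) (sub (s i) c) w′) (cong (_++ sub w′ b) (sub-sub (s i) b c))
  where
  substituted : InOrX (B i) c → InOrX (B i) (subst-x b c)
  substituted (inj₁ refl)          = allowed i ≤-refl
  substituted (inj₂ (a , refl , a∈)) = inj₂ (a , refl , a∈)

Prod-++ : Prod s B i l w → Prod s B (i + l) l′ w′ → Prod s B i (l + l′) (w ++ w′)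
Prod-++ {s = s} {B = B} {i = i} {l = zero} {l′ = l′} {w′ = w′} refl pr′ =
  subst (λ z → Prod s B z l′ w′) (+-identityʳ i) pr′
Prod-++ {s = s} {B = B} {i = i} {l = suc l} {l′ = l′} {w′ = w′} (c , c∈ , w₁ , pr , refl) pr′ =
  c , c∈ , w₁ ++ w′ , Prod-++ pr (subst (λ z → Prod s B z l′ w′) (+-suc i l) pr′) ,
  ++-assoc (sub (s i) c) w₁ w′

∸-+-∸ : i ≤ j → j ≤ k → (j ∸ i) + (k ∸ j) ≡ k ∸ i
∸-+-∸ {i} {j} {k} i≤j j≤k = begin
  (j ∸ i) + (k ∸ j)  ≡⟨ +-comm (j ∸ i) (k ∸ j) ⟩
  (k ∸ j) + (j ∸ i)  ≡⟨ +-∸-assoc (k ∸ j) i≤j ⟨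
  (k ∸ j + j) ∸ i    ≡⟨ cong (_∸ i) (m∸n+n≡m j≤k) ⟩
  k ∸ i              ∎
  where open ≡-Reasoning

Prod-++-∸ : i ≤ j → j ≤ k → Prod s B i (j ∸ i) w → Prod s B j (k ∸ j) w′ → Prod s B i (k ∸ i) (w ++ w′)
Prod-++-∸ {i = i} {j = j} {k = k} {s = s} {B = B} {w = w} {w′ = w′} i≤j j≤k pr pr′ =
  subst (λ z → Prod s B i z (w ++ w′)) (∸-+-∸ i≤j j≤k)
    (Prod-++ pr (subst (λ z → Prod s B z (k ∸ j) w′) (sym (m+[n∸m]≡n i≤j)) pr′))

Prod-shift : ∀ q {B′ : ℕ → List Sym} → (∀ j → B′ j ⊆ B (q + j))
  → Prod (λ j → s (q + j)) B′ i l w → Prod s B (q + i) l w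
Prod-shift {l = zero} q _ refl = refl
Prod-shift {B = B} {s = s} {i = i} {l = suc l} q B′⊆B (c , c∈ , w′ , pr , eq) =
  c , restrict c∈ , w′ , subst (λ z → Prod s B z l w′) (+-suc q i) (Prod-shift q B′⊆B pr) , eq
  where
  restrict : InOrX _ c → InOrX _ c
  restrict (inj₁ e)             = inj₁ e
  restrict (inj₂ (a , e , a∈)) = inj₂ (a , e , B′⊆B i a∈)

blockLength : (ℕ → Word Sym) → ℕ → ℕ → ℕ
blockLength s i zero    = 0
blockLength s i (suc l) = length (s i) + blockLength s (suc i) l

Prod-length : Prod s B i l w → length w ≡ blockLength s i l
Prod-length {l = zero} refl = refl
Prod-length {s = s} {i = i} {l = suc l} (b , _ , w′ , pr , refl) =
  trans (length-++ (sub (s i) b)) (cong₂ _+_ (length-map (subst-x b) (s i)) (Prod-length pr))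

blockLength-injective : (∀ j → 0 < length (s j)) → blockLength s i l ≡ blockLength s i l′ → l ≡ l′
blockLength-injective {l = zero}  {l′ = zero}   _ _ = refl
blockLength-injective {i = i} {l = zero} {l′ = suc _} nonempty e =
  contradiction e (<⇒≢ (≤-trans (nonempty i) (m≤m+n _ _)))
blockLength-injective {i = i} {l = suc _} {l′ = zero} nonempty e =
  contradiction (sym e) (<⇒≢ (≤-trans (nonempty i) (m≤m+n _ _)))
blockLength-injective {s = s} {i = i} {l = suc _} {l′ = suc _} nonempty e =
  cong suc (blockLength-injective nonempty (+-cancelˡ-≡ (length (s i)) _ _ e))

IsVar⇒nonempty : IsVar w → 0 < length w
IsVar⇒nonempty {w = _ ∷ _} _ = s≤s z≤n

module IncreasingUpTo (inc : ∀ i → i < L → N i < N (suc i)) where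

  mono-≤′ : i ≤′ j → j ≤ L → N i ≤ N j
  mono-≤′ ≤′-refl      _   = ≤-refl
  mono-≤′ (≤′-step i≤j) j<L = ≤-trans (mono-≤′ i≤j (<⇒≤ j<L)) (<⇒≤ (inc _ j<L))

  mono-≤ : i ≤ j → j ≤ L → N i ≤ N j
  mono-≤ = mono-≤′ ∘ ≤⇒≤′

  mono-< : i < j → j ≤ L → N i < N j
  mono-< {j = suc j} (s≤s i≤j) j<L = ≤-<-trans (mono-≤ i≤j (<⇒≤ j<L)) (inc j j<L)

  start+i≤ : i ≤ L → N 0 + i ≤ N i
  start+i≤ {zero}  _   = ≤-reflexive (+-identityʳ (N 0))
  start+i≤ {suc i} i<L = begin
    N 0 + suc i    ≡⟨ +-suc (N 0) i ⟩
    suc (N 0 + i)  ≤⟨ s≤s (start+i≤ (<⇒≤ i<L)) ⟩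
    suc (N i)      ≤⟨ inc i i<L ⟩
    N (suc i)      ∎
    where open ≤-Reasoning

record Blocks (A : ℕ → List Sym) (k : ℕ) (s u : ℕ → Word Sym) (L : ℕ) (N : ℕ → ℕ) : Set where
  field
    increasing : ∀ i → i < L → N i < N (suc i)
    product    : ∀ i → i < L → Prod s (λ n → A (k + n)) (N i) (N (suc i) ∸ N i) (u i)

open Blocks

FinBlockSub⇒Blocks : (f : FinBlockSub A k s u l) → Blocks A k s u (suc l) (proj₁ f)
FinBlockSub⇒Blocks (_ , _ , inc , spans) = record
  { increasing = λ i i<1+l → inc i (≤-pred i<1+l)
  ; product    = λ i i<1+l → proj₂ (spans i (≤-pred i<1+l))
  }

Blocks⇒FinBlockSub : (∀ i → IsVar (u i)) → N 0 ≡ 0 → Blocks A k s u (suc l) N → FinBlockSub A k s u l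
Blocks⇒FinBlockSub var N0≡0 bl =
  _ , N0≡0 , (λ i i≤l → increasing bl i (s≤s i≤l)) , λ i i≤l → var i , product bl i (s≤s i≤l)

Blocks-cong : (∀ i → u i ≡ t i) → Blocks A k s u L N → Blocks A k s t L N
Blocks-cong {A = A} {k = k} {s = s} {N = N} u≗t bl = record
  { increasing = increasing bl
  ; product    = λ i i<L → subst (Prod s (λ n → A (k + n)) (N i) _) (u≗t i) (product bl i i<L)
  }

_◃_ : X → (ℕ → X) → ℕ → X
(x ◃ f) zero    = x
(x ◃ f) (suc i) = f i

Blocks-◃ : a < N 0 → Prod s (λ n → A (k + n)) a (N 0 ∸ a) w → Blocks A k s u L N
  → Blocks A k s (w ◃ u) (suc L) (a ◃ N)
Blocks-◃ {a = a} {N = N} {s = s} {A = A} {k = k} {w = w} {u = u} {L = L} a<N0 pr bl =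
  record { increasing = inc ; product = prod }
  where
  inc : ∀ i → i < suc L → (a ◃ N) i < (a ◃ N) (suc i)
  inc zero    _       = a<N0
  inc (suc i) i+1<1+L = increasing bl i (≤-pred i+1<1+L)
  prod : ∀ i → i < suc L → Prod s (λ n → A (k + n)) ((a ◃ N) i) ((a ◃ N) (suc i) ∸ (a ◃ N) i) ((w ◃ u) i)
  prod zero    _       = pr
  prod (suc i) i+1<1+L = product bl i (≤-pred i+1<1+L)

Blocks-shift : ∀ q → Blocks A (k + q) (λ j → s (q + j)) u L M → Blocks A k s u L (λ i → q + M i)
Blocks-shift {A = A} {k = k} {s = s} {u = u} {M = M} q bl = record
  { increasing = λ i i<L → +-monoʳ-< q (increasing bl i i<L)
  ; product    = λ i i<L →
      subst (λ z → Prod s (λ n → A (k + n)) (q + M i) z (u i)) (sym ([m+n]∸[m+o]≡n∸o q _ _))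
        (Prod-shift q (λ j {x} → subst (λ z → x ∈ A z) (+-assoc k q j)) (product bl i i<L))
  }

Blocks-unique : (∀ j → 0 < length (s j)) → Blocks A k s u L N → Blocks A k s u L′ M → N 0 ≡ M 0
  → j ≤ L → j ≤ L′ → N j ≡ M j
Blocks-unique {j = zero}  _ _ _ N0≡M0 _ _ = N0≡M0
Blocks-unique {s = s} {u = u} {N = N} {M = M} {j = suc j} nonempty bN bM N0≡M0 j<L j<L′ = begin
  N (suc j)                ≡⟨ m+[n∸m]≡n (<⇒≤ (increasing bN j j<L)) ⟨
  N j + (N (suc j) ∸ N j)  ≡⟨ cong₂ _+_ Nj≡Mj same-width ⟩
  M j + (M (suc j) ∸ M j)  ≡⟨ m+[n∸m]≡n (<⇒≤ (increasing bM j j<L′)) ⟩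
  M (suc j)                ∎
  where
  open ≡-Reasoning
  Nj≡Mj : N j ≡ M j
  Nj≡Mj = Blocks-unique nonempty bN bM N0≡M0 (<⇒≤ j<L) (<⇒≤ j<L′)
  same-width : N (suc j) ∸ N j ≡ M (suc j) ∸ M j
  same-width = blockLength-injective nonempty (begin
    blockLength s (N j) (N (suc j) ∸ N j)  ≡⟨ Prod-length (product bN j j<L) ⟨
    length (u j)                           ≡⟨ Prod-length (product bM j j<L′) ⟩
    blockLength s (M j) (M (suc j) ∸ M j)  ≡⟨ cong (λ z → blockLength s z (M (suc j) ∸ M j)) Nj≡Mj ⟨
    blockLength s (N j) (M (suc j) ∸ M j)  ∎)

module _ (A-step : ∀ n → A n ⊆ A (suc n)) where

  A-mono : i ≤ j → A i ⊆ A j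
  A-mono i≤j = go (≤⇒≤′ i≤j)
    where
    go : i ≤′ j → A i ⊆ A j
    go ≤′-refl       = λ a∈ → a∈
    go (≤′-step i≤j) = A-step _ ∘ go i≤j

  -- Alphabets only grow along s, so a letter allowed at position a of u is allowed
  -- everywhere in s from the start N a of the a-th block on.
  Prod-through-Blocks : Blocks A k s u L N → k′ ≤ k + N 0 → a + l ≡ e → e ≤ L
    → Prod u (λ n → A (k′ + n)) a l w → Prod s (λ n → A (k + n)) (N a) (N e ∸ N a) w
  Prod-through-Blocks {N = N} {a = a} {l = zero} _ _ refl _ refl
    rewrite +-identityʳ a | n∸n≡0 (N a) = refl
  Prod-through-Blocks {k = k} {L = L} {N = N} {k′ = k′} {a = a} {l = suc l}
    bl k′≤ refl e≤L (b , b∈ , w′ , pr , refl) =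
    Prod-++-∸ (<⇒≤ (increasing bl a a<L)) (mono-≤ a<e e≤L)
      (Prod-sub allowed (product bl a a<L))
      (Prod-through-Blocks bl k′≤ (sym (+-suc a l)) e≤L pr)
    where
    open IncreasingUpTo (increasing bl)
    a<e : a < a + suc l
    a<e = m<m+n a (s≤s z≤n)
    a<L : a < L
    a<L = <-≤-trans a<e e≤L
    k′+a≤ : ∀ {j} → N a ≤ j → k′ + a ≤ k + j
    k′+a≤ {j} Na≤j = begin
      k′ + a       ≤⟨ +-monoˡ-≤ a k′≤ ⟩
      k + N 0 + a  ≡⟨ +-assoc k (N 0) a ⟩
      k + (N 0 + a) ≤⟨ +-monoʳ-≤ k (≤-trans (start+i≤ (<⇒≤ a<L)) Na≤j) ⟩
      k + j        ∎
      where open ≤-Reasoning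
    allowed′ : ∀ {j} → N a ≤ j → InOrX (A (k′ + a)) b → InOrX (A (k + j)) b
    allowed′ _    (inj₁ e)             = inj₁ e
    allowed′ Na≤j (inj₂ (c , e , c∈)) = inj₂ (c , e , A-mono (k′+a≤ Na≤j) c∈)
    allowed : ∀ j → N a ≤ j → InOrX (A (k + j)) b
    allowed j Na≤j = allowed′ Na≤j b∈

  Blocks-∘ : Blocks A k s u L′ N → Blocks A k′ u t L M → M L ≤ L′ → k′ ≤ k + N 0
    → Blocks A k s t L (N ∘ M)
  Blocks-∘ {L′ = L′} {N = N} {L = L} {M = M} bN bM ML≤L′ k′≤ = record
    { increasing = λ i i<L → IncN.mono-< (increasing bM i i<L) (M≤L′ i<L)
    ; product    = λ i i<L →
        Prod-through-Blocks bN k′≤ (m+[n∸m]≡n (<⇒≤ (increasing bM i i<L))) (M≤L′ i<L)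
          (product bM i i<L)
    }
    where
    module IncN = IncreasingUpTo (increasing bN)
    module IncM = IncreasingUpTo (increasing bM)
    M≤L′ : i < L → M (suc i) ≤ L′
    M≤L′ i<L = ≤-trans (IncM.mono-≤ i<L ≤-refl) ML≤L′

module Construction
  {Sym : Set} (A : ℕ → List Sym) (A-step : ∀ n → A n ⊆ A (suc n))
  (t : ℕ → ℕ → Word Sym) (t-var : ∀ n i → IsVar (t n i))
  (w : ℕ → Word Sym) (k m : ℕ → ℕ)
  (m≥1 : ∀ n → 1 ≤ m (suc n))
  (k-suc : ∀ n → k (suc n) ≡ k n + m (suc n))
  (w-span : ∀ n → Span (t n) (λ i → A (k n + i)) 0 (m (suc n)) (w n))
  (t-sub : ∀ n → InfBlockSub A (k (suc n)) (λ i → t n (m (suc n) + i)) (t (suc n)))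
  where

  tail-Blocks : ∀ n l → Σ (ℕ → ℕ) λ N → N 0 ≡ m (suc n) × Blocks A (k n) (t n) (t (suc n)) (suc l) N
  tail-Blocks n l = (λ i → m (suc n) + H i) , trans (cong (m (suc n) +_) H0≡0) (+-identityʳ _) ,
    Blocks-shift (m (suc n))
      (subst (λ z → Blocks A z (λ j → t n (m (suc n) + j)) (t (suc n)) (suc l) H) (k-suc n)
        (FinBlockSub⇒Blocks (t-sub n l)))
    where
    H = proj₁ (t-sub n l)
    H0≡0 = proj₁ (proj₂ (t-sub n l))

  record Placement (n L : ℕ) : Set where
    field
      bounds      : ℕ → ℕ
      starts-at-0 : bounds 0 ≡ 0
      k-below     : ∀ i → i ≤ L → k (n + i) ≤ k n + bounds i
      blocks      : Blocks A (k n) (t n) (λ i → w (n + i)) L bounds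

  k[n+0]≤k[n]+0 : ∀ n → k (n + 0) ≤ k n + 0
  k[n+0]≤k[n]+0 n = ≤-reflexive (trans (cong k (+-identityʳ n)) (sym (+-identityʳ (k n))))

  placement : ∀ n L → Placement n L
  placement n zero = record
    { bounds      = λ _ → 0
    ; starts-at-0 = refl
    ; k-below     = λ { zero _ → k[n+0]≤k[n]+0 n }
    ; blocks      = record { increasing = λ _ () ; product = λ _ () }
    }
  placement n (suc L) = record
    { bounds      = 0 ◃ (H ∘ G)
    ; starts-at-0 = refl
    ; k-below     = k-below′
    ; blocks      = Blocks-cong reindex (Blocks-◃ (subst (0 <_) (sym first) (m≥1 n)) first-block composed)
    }
    where
    open Placement (placement (suc n) L) renaming (bounds to G; starts-at-0 to G0≡0; k-below to G-k-below; blocks to G-blocks)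
    H = proj₁ (tail-Blocks n (G L))
    H0≡m = proj₁ (proj₂ (tail-Blocks n (G L)))
    H-blocks = proj₂ (proj₂ (tail-Blocks n (G L)))
    first : H (G 0) ≡ m (suc n)
    first = trans (cong H G0≡0) H0≡m
    first-block : Prod (t n) (λ j → A (k n + j)) 0 (H (G 0)) (w n)
    first-block = subst (λ z → Prod (t n) (λ j → A (k n + j)) 0 z (w n)) (sym first) (proj₂ (w-span n))
    composed : Blocks A (k n) (t n) (λ i → w (suc n + i)) L (H ∘ G)
    composed = Blocks-∘ A-step H-blocks G-blocks (n≤1+n (G L))
      (≤-reflexive (trans (k-suc n) (cong (k n +_) (sym H0≡m))))
    reindex : ∀ i → (w n ◃ (λ i → w (suc n + i))) i ≡ w (n + i)
    reindex zero    = cong w (sym (+-identityʳ n))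
    reindex (suc i) = cong w (sym (+-suc n i))
    k-below′ : ∀ i → i ≤ suc L → k (n + i) ≤ k n + (0 ◃ (H ∘ G)) i
    k-below′ zero    _          = k[n+0]≤k[n]+0 n
    k-below′ (suc i) i+1≤L+1 = begin
      k (n + suc i)           ≡⟨ cong k (+-suc n i) ⟩
      k (suc n + i)           ≤⟨ G-k-below i i≤L ⟩
      k (suc n) + G i         ≡⟨ cong (_+ G i) (k-suc n) ⟩
      k n + m (suc n) + G i   ≡⟨ +-assoc (k n) (m (suc n)) (G i) ⟩
      k n + (m (suc n) + G i) ≡⟨ cong (λ z → k n + (z + G i)) H0≡m ⟨
      k n + (H 0 + G i)       ≤⟨ +-monoʳ-≤ (k n) (IncreasingUpTo.start+i≤ (increasing H-blocks) Gi≤) ⟩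
      k n + H (G i)           ∎
      where
      open ≤-Reasoning
      i≤L = ≤-pred i+1≤L+1
      Gi≤ : G i ≤ suc (G L)
      Gi≤ = ≤-trans (IncreasingUpTo.mono-≤ (increasing G-blocks) i≤L ≤-refl) (n≤1+n (G L))

  boundary : ℕ → ℕ → ℕ
  boundary L = Placement.bounds (placement 0 L)

  boundary-stable : ∀ n → boundary (suc n) n ≡ boundary n n
  boundary-stable n = Blocks-unique (IsVar⇒nonempty ∘ t-var 0)
    (Placement.blocks (placement 0 (suc n))) (Placement.blocks (placement 0 n))
    (sym (Placement.starts-at-0 (placement 0 n))) (n≤1+n n) ≤-refl

lemma7 : {Sym : Set} (A : ℕ → List Sym)
    → (∀ n → A n ≢ [])
    → (∀ n {a} → a ∈ A n → a ∈ A (suc n))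
    → (∀ a → ∃ λ n → a ∈ A n)
    → (t : ℕ → ℕ → Word Sym) → (∀ n i → IsVar (t n i))
    → (w : ℕ → Word Sym) → (∀ n → IsVar (w n))
    → (k m : ℕ → ℕ) → m 0 ≡ 0
    → (∀ n → 1 ≤ m (suc n))
    → (∀ n → k (suc n) ≡ k n + m (suc n))
    → (∀ n → Span (t n) (λ i → A (k n + i)) 0 (m (suc n)) (w n))
    → (∀ n → InfBlockSub A (k (suc n)) (λ i → t n (m (suc n) + i)) (t (suc n)))
    → Σ (ℕ → ℕ) λ p → (p 0 ≡ 0) × (∀ n → p n < p (suc n))
        × (∀ n → (k n ≤ k 0 + p n)
             × Span (t 0) (λ i → A (k 0 + i)) (p n) (p (suc n) ∸ p n) (w n)
             × InfBlockSub A (k n) (t n) (λ i → w (n + i)))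
lemma7 A _ A-step _ t t-var w w-var k m _ m≥1 k-suc w-span t-sub =
  p , refl , p-increasing , λ n → k-below (placement 0 n) n ≤-refl , (w-var n , w-block n) , C3 n
  where
  open Construction A A-step t t-var w k m m≥1 k-suc w-span t-sub
  open Placement
  p : ℕ → ℕ
  p n = boundary n n
  block : ∀ n → Prod (t 0) (λ i → A (k 0 + i)) (boundary (suc n) n) (p (suc n) ∸ boundary (suc n) n) (w n)
  block n = product (blocks (placement 0 (suc n))) n ≤-refl
  p-increasing : ∀ n → p n < p (suc n)
  p-increasing n =
    subst (_< p (suc n)) (boundary-stable n) (increasing (blocks (placement 0 (suc n))) n ≤-refl)
  w-block : ∀ n → Prod (t 0) (λ i → A (k 0 + i)) (p n) (p (suc n) ∸ p n) (w n)
  w-block n =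
    subst (λ z → Prod (t 0) (λ i → A (k 0 + i)) z (p (suc n) ∸ z) (w n)) (boundary-stable n) (block n)
  C3 : ∀ n → InfBlockSub A (k n) (t n) (λ i → w (n + i))
  C3 n l = Blocks⇒FinBlockSub (w-var ∘ (n +_)) (starts-at-0 (placement n (suc l))) (blocks (placement n (suc l)))
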